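{- For any undirected graph $H$ and any acyclic orientation $\vec H$ of $H$, $\operatorname{dtw}(\vec H)\le \mathrm{tw}(H)+1$.
   Context: $\mathrm{tw}$ denotes treewidth. For a DAG $\vec H$, a source is a vertex of indegree $0$, $S$ is the set of sources, $R(s)$ is the set of vertices reachable from $s$ by a directed path, and $R(B)=\bigcup_{s\in B}R(s)$. A DAG tree decomposition of $\vec H$ is a tree whose nodes are bags $B\subseteq S$ such that every source lies in some bag and, for any bags $B,B_1,B_2$ with $B$ on the unique path between $B_1$ and $B_2$, $R(B_1)\cap R(B_2)\subseteq R(B)$; its width is the maximum bag size and $\operatorname{dtw}(\vec H)$ is the minimum width. -}

module Defs where

open import Data.Nat using (ℕ; suc; _≤_)
open import Data.Fin using (Fin)
open import Data.Fin.Subset using (Subset; _∈_; ∣_∣)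
open import Data.Bool using (Bool; true; false)
open import Data.List using (List; []; _∷_)
open import Data.List.Relation.Unary.Unique.Propositional using (Unique)
import Data.List.Membership.Propositional as LM
open import Data.Product using (Σ; ∃; ∃-syntax; _×_)
open import Data.Sum using (_⊎_)
open import Relation.Nullary using (¬_)
open import Relation.Binary.PropositionalEquality using (_≡_)
open import Relation.Binary.Construct.Closure.ReflexiveTransitive using (Star)

record Graph (n : ℕ) : Set where
  field
    adj     : Fin n → Fin n → Bool
    sym     : ∀ u v → adj u v ≡ true → adj v u ≡ true
    irrefl  : ∀ u → adj u u ≡ false

data PathIn {t : ℕ} (A : Fin t → Fin t → Bool) : Fin t → Fin t → List (Fin t) → Set where
  here : ∀ i → PathIn A i i (i ∷ [])
  step : ∀ {i k j xs} → A i k ≡ true → PathIn A k j xs → PathIn A i j (i ∷ xs)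

SimplePath : {t : ℕ} → (Fin t → Fin t → Bool) → Fin t → Fin t → List (Fin t) → Set
SimplePath A i j xs = PathIn A i j xs × Unique xs

record Tree : Set where
  field
    size    : ℕ
    graph   : Graph (suc size)
    path    : ∀ i j → ∃[ xs ] SimplePath (Graph.adj graph) i j xs
    unique  : ∀ {i j xs ys} → SimplePath (Graph.adj graph) i j xs
                           → SimplePath (Graph.adj graph) i j ys → xs ≡ ys

  Node : Set
  Node = Fin (suc size)

  OnPath : Node → Node → Node → Set
  OnPath l i j = ∃[ xs ] (SimplePath (Graph.adj graph) i j xs × l LM.∈ xs)

record TreeDecomposition {n : ℕ} (G : Graph n) : Set where
  field
    tree      : Tree
  open Tree tree public
  field
    bag       : Node → Subset n
    vcover    : ∀ v → ∃[ i ] (v ∈ bag i)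
    ecover    : ∀ u v → Graph.adj G u v ≡ true → ∃[ i ] (u ∈ bag i × v ∈ bag i)
    coherent  : ∀ {l i j} → OnPath l i j → ∀ v → v ∈ bag i → v ∈ bag j → v ∈ bag l

-- Maximum bag size of a tree decomposition is at most m.
-- (The width of a tree decomposition is its max bag size minus 1, so
--  tw(H) + 1 ≤ m  iff  H has a tree decomposition with all bags of size ≤ m.)
TDBagsAtMost : {n : ℕ} {G : Graph n} → TreeDecomposition G → ℕ → Set
TDBagsAtMost D m = ∀ i → ∣ TreeDecomposition.bag D i ∣ ≤ m

TwPlusOneAtMost : {n : ℕ} → Graph n → ℕ → Set
TwPlusOneAtMost G m = Σ (TreeDecomposition G) λ D → TDBagsAtMost D m

record AcyclicOrientation {n : ℕ} (G : Graph n) : Set where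
  field
    arc       : Fin n → Fin n → Bool
    arc⇒edge  : ∀ u v → arc u v ≡ true → Graph.adj G u v ≡ true
    edge⇒arc  : ∀ u v → Graph.adj G u v ≡ true → arc u v ≡ true ⊎ arc v u ≡ true
    oneWay    : ∀ u v → arc u v ≡ true → arc v u ≡ false

  Arc : Fin n → Fin n → Set
  Arc u v = arc u v ≡ true

  Reach : Fin n → Fin n → Set
  Reach = Star Arc

  field
    acyclic   : ∀ u v → Arc u v → ¬ Reach v u

  IsSource : Fin n → Set
  IsSource s = ∀ u → ¬ Arc u s

  InR : Subset n → Fin n → Set
  InR B v = ∃[ s ] (s ∈ B × Reach s v)

record DAGTreeDecomposition {n : ℕ} {G : Graph n} (O : AcyclicOrientation G) : Set where
  open AcyclicOrientation O
  field
    tree      : Tree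
  open Tree tree public
  field
    bag       : Node → Subset n
    sources   : ∀ i v → v ∈ bag i → IsSource v
    scover    : ∀ s → IsSource s → ∃[ i ] (s ∈ bag i)
    coherent  : ∀ {l i j} → OnPath l i j → ∀ v → InR (bag i) v → InR (bag j) v → InR (bag l) v

-- dtw(O) ≤ m  (width of a DAG tree decomposition = max bag size)
DtwAtMost : {n : ℕ} {G : Graph n} → AcyclicOrientation G → ℕ → Set
DtwAtMost O m = Σ (DAGTreeDecomposition O) λ D → ∀ i → ∣ DAGTreeDecomposition.bag D i ∣ ≤ m

-- Replace every vertex w of a bag of a tree decomposition of H by minSource w, the source of least
-- index reaching w; bags do not grow, and every source s stays covered since minSource s = s.
-- If minSource w₁ and minSource w₂ both reach v, then w₁ ← minSource w₁ → v ← minSource w₂ → w₂ is a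
-- walk in H through vertices x whose minSource x still reaches v (minimality makes minSource constant
-- on a path from minSource w to w). A connected vertex set meeting the bags i and j meets every bag
-- on the tree path between them, which yields the DAG coherence condition.
module Submission where

open import Defs
open import Data.Bool using (Bool; true)
open import Data.Bool.Properties using () renaming (_≟_ to _≟ᵇ_)
open import Data.Nat using (ℕ; zero; suc; _+_; _≤_; _<_; z≤n; s≤s)
open import Data.Nat.Properties
  using (≤-reflexive; ≤-trans; ≤⇒≯; +-monoʳ-≤; +-suc; +-identityʳ; module ≤-Reasoning)
open import Data.Fin as Fin using (Fin; zero; suc; toℕ; fromℕ<)
open import Data.Fin.Properties using (_≟_; any?; all?; toℕ-fromℕ<) renaming (≤-antisym to ≤ᶠ-antisym)
open import Data.Fin.Subset using (Subset; inside; outside; _⊂_; ∣_∣; ⊥; ⁅_⁆; _∪_)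
  renaming (_∈_ to _∈ˢ_)
open import Data.Fin.Subset.Properties
  using (∉⊥; ∣⊥∣≡0; ∣⁅x⁆∣≡1; x∈⁅x⁆; x∈⁅y⁆⇒x≡y; x∈p∪q⁺; x∈p∪q⁻; q⊆p∪q; ∣p∣≤n; ∣p∣≤∣x∷p∣;
         drop-∷-⊆; drop-∷-⊂; p⊆q⇒∣p∣≤∣q∣)
open import Data.Vec using (_∷_) renaming ([] to []ᵛ; here to hereᵛ; there to thereᵛ)
open import Data.List using ([]; _∷_; _++_)
open import Data.List.Relation.Unary.Any using (here; there)
import Data.List.Relation.Unary.All as All
open import Data.List.Relation.Unary.All.Properties using (¬Any⇒All¬)
open import Data.List.Relation.Unary.AllPairs using ([]; _∷_)
open import Data.List.Relation.Unary.Unique.Propositional using (Unique)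
open import Data.List.Membership.Propositional using (_∈_)
open import Data.List.Membership.Propositional.Properties using (∈-++⁻)
open import Data.List.Relation.Binary.Subset.Propositional using (_⊆_)
open import Data.List.Relation.Binary.Subset.Propositional.Properties
  using (⊆-refl; ⊆-trans; xs⊆x∷xs; ∷⁺ʳ)
open import Data.Product using (_×_; _,_; proj₁; proj₂; ∃-syntax)
open import Data.Sum using (_⊎_; inj₁; inj₂)
open import Function using (_∘_)
open import Relation.Nullary using (Dec; yes; no; contradiction)
open import Relation.Nullary.Decidable using (map′; _×-dec_; ¬?)
open import Relation.Unary using (Pred; Decidable)
open import Relation.Binary.PropositionalEquality using (_≡_; refl; sym; cong; subst)
open import Relation.Binary.Construct.Closure.ReflexiveTransitive using (Star; ε; _◅_; _◅◅_; reverse)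

∣p∪q∣≤∣p∣+∣q∣ : ∀ {n} (p q : Subset n) → ∣ p ∪ q ∣ ≤ ∣ p ∣ + ∣ q ∣
∣p∪q∣≤∣p∣+∣q∣ []ᵛ           []ᵛ           = z≤n
∣p∪q∣≤∣p∣+∣q∣ (inside  ∷ p) (t       ∷ q) =
  s≤s (≤-trans (∣p∪q∣≤∣p∣+∣q∣ p q) (+-monoʳ-≤ ∣ p ∣ (∣p∣≤∣x∷p∣ t q)))
∣p∪q∣≤∣p∣+∣q∣ (outside ∷ p) (inside  ∷ q) =
  subst (suc ∣ p ∪ q ∣ ≤_) (sym (+-suc ∣ p ∣ ∣ q ∣)) (s≤s (∣p∪q∣≤∣p∣+∣q∣ p q))
∣p∪q∣≤∣p∣+∣q∣ (outside ∷ p) (outside ∷ q) = ∣p∪q∣≤∣p∣+∣q∣ p q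

p⊂q⇒∣p∣<∣q∣ : ∀ {n} {p q : Subset n} → p ⊂ q → ∣ p ∣ < ∣ q ∣
p⊂q⇒∣p∣<∣q∣ {p = []ᵛ}         {[]ᵛ}         (_ , () , _)
p⊂q⇒∣p∣<∣q∣ {p = outside ∷ p} {outside ∷ q} p⊂q       = p⊂q⇒∣p∣<∣q∣ (drop-∷-⊂ p⊂q)
p⊂q⇒∣p∣<∣q∣ {p = outside ∷ p} {inside  ∷ q} (p⊆q , _) = s≤s (p⊆q⇒∣p∣≤∣q∣ (drop-∷-⊆ p⊆q))
p⊂q⇒∣p∣<∣q∣ {p = inside  ∷ p} {outside ∷ q} (p⊆q , _) = contradiction (p⊆q hereᵛ) λ ()
p⊂q⇒∣p∣<∣q∣ {p = inside  ∷ p} {inside  ∷ q} p⊂q       = s≤s (p⊂q⇒∣p∣<∣q∣ (drop-∷-⊂ p⊂q))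

image : ∀ {m n} → (Fin m → Fin n) → Subset m → Subset n
image f []ᵛ           = ⊥
image f (outside ∷ p) = image (f ∘ suc) p
image f (inside  ∷ p) = ⁅ f zero ⁆ ∪ image (f ∘ suc) p

∈-image⁺ : ∀ {m n} (f : Fin m → Fin n) {x p} → x ∈ˢ p → f x ∈ˢ image f p
∈-image⁺ f {p = inside  ∷ p} hereᵛ        = x∈p∪q⁺ (inj₁ (x∈⁅x⁆ (f zero)))
∈-image⁺ f {p = outside ∷ p} (thereᵛ x∈p) = ∈-image⁺ (f ∘ suc) x∈p
∈-image⁺ f {p = inside  ∷ p} (thereᵛ x∈p) = x∈p∪q⁺ (inj₂ (∈-image⁺ (f ∘ suc) x∈p))

∈-image⁻ : ∀ {m n} (f : Fin m → Fin n) p {y} → y ∈ˢ image f p → ∃[ x ] (x ∈ˢ p × f x ≡ y)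
∈-image⁻ f []ᵛ           y∈ = contradiction y∈ ∉⊥
∈-image⁻ f (outside ∷ p) y∈ with ∈-image⁻ (f ∘ suc) p y∈
... | x , x∈p , fx≡y = suc x , thereᵛ x∈p , fx≡y
∈-image⁻ f (inside  ∷ p) y∈ with x∈p∪q⁻ ⁅ f zero ⁆ (image (f ∘ suc) p) y∈
... | inj₁ y∈⁅f0⁆ = zero , hereᵛ , sym (x∈⁅y⁆⇒x≡y (f zero) y∈⁅f0⁆)
... | inj₂ y∈img with ∈-image⁻ (f ∘ suc) p y∈img
...   | x , x∈p , fx≡y = suc x , thereᵛ x∈p , fx≡y

∣image∣≤∣p∣ : ∀ {m n} (f : Fin m → Fin n) p → ∣ image f p ∣ ≤ ∣ p ∣
∣image∣≤∣p∣ {n = n} f []ᵛ = ≤-reflexive (∣⊥∣≡0 n)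
∣image∣≤∣p∣ f (outside ∷ p) = ∣image∣≤∣p∣ (f ∘ suc) p
∣image∣≤∣p∣ f (inside  ∷ p) = begin
  ∣ ⁅ f zero ⁆ ∪ image (f ∘ suc) p ∣      ≤⟨ ∣p∪q∣≤∣p∣+∣q∣ ⁅ f zero ⁆ _ ⟩
  ∣ ⁅ f zero ⁆ ∣ + ∣ image (f ∘ suc) p ∣  ≡⟨ cong (_+ ∣ image (f ∘ suc) p ∣) (∣⁅x⁆∣≡1 (f zero)) ⟩
  suc ∣ image (f ∘ suc) p ∣              ≤⟨ s≤s (∣image∣≤∣p∣ (f ∘ suc) p) ⟩
  suc ∣ p ∣                              ∎
  where open ≤-Reasoning

least-witness : ∀ {n p} {P : Pred (Fin n) p} → Decidable P → ∃[ i ] P i →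
                ∃[ i ] (P i × (∀ j → P j → i Fin.≤ j))
least-witness {suc n} P? (i , Pi) with P? zero
... | yes P0 = zero , P0 , λ _ _ → z≤n
... | no ¬P0 with i
...   | zero  = contradiction Pi ¬P0
...   | suc i with least-witness (P? ∘ suc) (i , Pi)
...     | k , Pk , min = suc k , Pk , λ { zero P0 → contradiction P0 ¬P0 ; (suc j) Pj → s≤s (min j Pj) }

module _ {t : ℕ} {A : Fin t → Fin t → Bool} where
  open import Data.List.Membership.DecPropositional (_≟_ {t}) using (_∈?_)

  PathIn-++ : ∀ {i c j xs ys} → PathIn A i c xs → PathIn A c j ys →
              ∃[ zs ] (PathIn A i j zs × zs ⊆ xs ++ ys)
  PathIn-++ {ys = ys} (here i) q = ys , q , xs⊆x∷xs ys i
  PathIn-++ (step a p) q with PathIn-++ p q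
  ... | zs , r , zs⊆ = _ , step a r , ∷⁺ʳ _ zs⊆

  simple-suffix : ∀ {k j x ys} → PathIn A k j ys → Unique ys → x ∈ ys →
                  ∃[ zs ] (SimplePath A x j zs × zs ⊆ ys)
  simple-suffix p@(here _)   u       (here refl) = _ , (p , u) , ⊆-refl
  simple-suffix p@(step _ _) u       (here refl) = _ , (p , u) , ⊆-refl
  simple-suffix (step _ p)   (_ ∷ u) (there x∈) with simple-suffix p u x∈
  ... | zs , sp , zs⊆ = zs , sp , ⊆-trans zs⊆ (xs⊆x∷xs _ _)

  loop-erase : ∀ {i j xs} → PathIn A i j xs → ∃[ zs ] (SimplePath A i j zs × zs ⊆ xs)
  loop-erase (here i) = _ , (here i , All.[] ∷ []) , ⊆-refl
  loop-erase {i} (step a p) with loop-erase p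
  ... | ys , (q , u) , ys⊆ with i ∈? ys
  ...   | yes i∈ys = let (zs , sp , zs⊆) = simple-suffix q u i∈ys
                     in zs , sp , ⊆-trans zs⊆ (⊆-trans ys⊆ (xs⊆x∷xs _ _))
  ...   | no  i∉ys = i ∷ ys , (step a q , ¬Any⇒All¬ ys i∉ys ∷ u) , ∷⁺ʳ i ys⊆

module _ (T : Tree) where
  open Tree T

  -- The unique i–j path is the loop erasure of the walk through c.
  OnPath-split : ∀ {l i j} → OnPath l i j → ∀ c → OnPath l i c ⊎ OnPath l c j
  OnPath-split {l} {i} {j} (xs , sp , l∈xs) c with path i c | path c j
  ... | ys , sp₁ | zs , sp₂ with PathIn-++ (proj₁ sp₁) (proj₁ sp₂)
  ... | ws , w , ws⊆ with loop-erase w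
  ... | vs , sv , vs⊆ with unique sv sp
  ... | refl with ∈-++⁻ ys (ws⊆ (vs⊆ l∈xs))
  ... | inj₁ l∈ys = inj₁ (ys , sp₁ , l∈ys)
  ... | inj₂ l∈zs = inj₂ (zs , sp₂ , l∈zs)

InducedEdge : ∀ {n} → Graph n → (Fin n → Set) → Fin n → Fin n → Set
InducedEdge G P u v = P u × P v × Graph.adj G u v ≡ true

module _ {n} {G : Graph n} (D : TreeDecomposition G) where
  open TreeDecomposition D

  induced-walk-meets-bag : ∀ {P : Fin n → Set} {x y l i j} → Star (InducedEdge G P) x y → P x →
                           x ∈ˢ bag i → y ∈ˢ bag j → OnPath l i j → ∃[ z ] (P z × z ∈ˢ bag l)
  induced-walk-meets-bag ε Px x∈i x∈j l∈ij = _ , Px , coherent l∈ij _ x∈i x∈j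
  induced-walk-meets-bag ((_ , Px' , e) ◅ w) Px x∈i y∈j l∈ij with ecover _ _ e
  ... | c , x∈c , x'∈c with OnPath-split tree l∈ij c
  ... | inj₁ l∈ic = _ , Px , coherent l∈ic _ x∈i x∈c
  ... | inj₂ l∈cj = induced-walk-meets-bag w Px' x'∈c y∈j l∈cj

module AcyclicOrientationProperties {n} {G : Graph n} (O : AcyclicOrientation G) where
  open AcyclicOrientation O

  data ReachIn : ℕ → Fin n → Fin n → Set where
    ε   : ∀ {u} → ReachIn 0 u u
    _◅_ : ∀ {k u w v} → Arc u w → ReachIn k w v → ReachIn (suc k) u v

  ReachIn⇒Reach : ∀ {k u v} → ReachIn k u v → Reach u v
  ReachIn⇒Reach ε       = ε
  ReachIn⇒Reach (a ◅ p) = a ◅ ReachIn⇒Reach p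

  Reach⇒ReachIn : ∀ {u v} → Reach u v → ∃[ k ] ReachIn k u v
  Reach⇒ReachIn ε       = 0 , ε
  Reach⇒ReachIn (a ◅ r) = let (k , p) = Reach⇒ReachIn r in suc k , a ◅ p

  vertices : ∀ {k u v} → ReachIn k u v → Subset n
  vertices {u = u} ε       = ⁅ u ⁆
  vertices {u = u} (_ ◅ p) = ⁅ u ⁆ ∪ vertices p

  ∈-vertices⇒Reach : ∀ {k u v x} (p : ReachIn k u v) → x ∈ˢ vertices p → Reach u x
  ∈-vertices⇒Reach {u = u} ε x∈ with x∈⁅y⁆⇒x≡y u x∈
  ... | refl = ε
  ∈-vertices⇒Reach {u = u} (a ◅ p) x∈ with x∈p∪q⁻ ⁅ u ⁆ (vertices p) x∈
  ... | inj₁ x∈⁅u⁆ with x∈⁅y⁆⇒x≡y u x∈⁅u⁆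
  ...   | refl = ε
  ∈-vertices⇒Reach (a ◅ p) x∈ | inj₂ x∈p = a ◅ ∈-vertices⇒Reach p x∈p

  -- Acyclicity keeps the first vertex out of the rest of the path, so each arc adds a vertex.
  ∣vertices∣ : ∀ {k u v} (p : ReachIn k u v) → suc k ≤ ∣ vertices p ∣
  ∣vertices∣ {u = u} ε       = ≤-reflexive (sym (∣⁅x⁆∣≡1 u))
  ∣vertices∣ {u = u} (a ◅ p) = ≤-trans (s≤s (∣vertices∣ p)) (p⊂q⇒∣p∣<∣q∣ vertices-p⊂)
    where
    vertices-p⊂ : vertices p ⊂ ⁅ u ⁆ ∪ vertices p
    vertices-p⊂ = q⊆p∪q ⁅ u ⁆ (vertices p) , u , x∈p∪q⁺ (inj₁ (x∈⁅x⁆ u)) ,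
                  λ u∈p → acyclic _ _ a (∈-vertices⇒Reach p u∈p)

  ReachIn-length<n : ∀ {k u v} → ReachIn k u v → k < n
  ReachIn-length<n p = ≤-trans (∣vertices∣ p) (∣p∣≤n (vertices p))

  ReachIn? : ∀ k u v → Dec (ReachIn k u v)
  ReachIn? zero    u v = map′ (λ { refl → ε }) (λ { ε → refl }) (u ≟ v)
  ReachIn? (suc k) u v = map′ (λ (_ , a , p) → a ◅ p) (λ { (a ◅ p) → _ , a , p })
                              (any? λ w → (arc u w ≟ᵇ true) ×-dec ReachIn? k w v)

  Reach? : ∀ u v → Dec (Reach u v)
  Reach? u v = map′ (ReachIn⇒Reach ∘ proj₂) from (any? λ k → ReachIn? (toℕ k) u v)
    where
    from : Reach u v → ∃[ k ] ReachIn (toℕ k) u v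
    from r with Reach⇒ReachIn r
    ... | k , p = fromℕ< (ReachIn-length<n p) , subst (λ k → ReachIn k u v) (sym (toℕ-fromℕ< _)) p

  IsSource? : Decidable IsSource
  IsSource? s = all? λ u → ¬? (arc u s ≟ᵇ true)

  source-reaching : ∀ v → ∃[ s ] (IsSource s × Reach s v)
  source-reaching v = extend n ε (≤-reflexive (sym (+-identityʳ n)))
    where
    -- Extend a path ending at v backwards until it starts at a source; by the invariant n ≤ f + k,
    -- running out of fuel would give a path with n arcs.
    extend : ∀ f {k u} → ReachIn k u v → n ≤ f + k → ∃[ s ] (IsSource s × Reach s v)
    extend zero          p n≤k = contradiction (ReachIn-length<n p) (≤⇒≯ n≤k)
    extend (suc f) {k} {u} p n≤ with any? (λ w → arc w u ≟ᵇ true)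
    ... | yes (w , a) = extend f (a ◅ p) (subst (n ≤_) (sym (+-suc f k)) n≤)
    ... | no  ¬a      = u , (λ w a → ¬a (w , a)) , ReachIn⇒Reach p

  least-source : ∀ v → ∃[ s ] ((IsSource s × Reach s v) × (∀ t → IsSource t × Reach t v → s Fin.≤ t))
  least-source v = least-witness (λ s → IsSource? s ×-dec Reach? s v) (source-reaching v)

  minSource : Fin n → Fin n
  minSource v = proj₁ (least-source v)

  minSource-isSource : ∀ v → IsSource (minSource v)
  minSource-isSource v = proj₁ (proj₁ (proj₂ (least-source v)))

  minSource-reaches : ∀ v → Reach (minSource v) v
  minSource-reaches v = proj₂ (proj₁ (proj₂ (least-source v)))

  minSource-least : ∀ {t v} → IsSource t → Reach t v → minSource v Fin.≤ t
  minSource-least {t} {v} src r = proj₂ (proj₂ (least-source v)) t (src , r)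

  -- x lies between minSource w and w, so each of the two sources reaches both x and w.
  minSource-between : ∀ {w x} → Reach (minSource w) x → Reach x w → minSource x ≡ minSource w
  minSource-between {w} {x} r₁ r₂ =
    ≤ᶠ-antisym (minSource-least (minSource-isSource w) r₁)
               (minSource-least (minSource-isSource x) (minSource-reaches x ◅◅ r₂))

  source-reached-only-from-itself : ∀ {s u} → IsSource s → Reach u s → u ≡ s
  source-reached-only-from-itself src ε       = refl
  source-reached-only-from-itself src (a ◅ r) with source-reached-only-from-itself src r
  ... | refl = contradiction a (src _)

  minSource-source : ∀ {s} → IsSource s → minSource s ≡ s
  minSource-source {s} src = source-reached-only-from-itself src (minSource-reaches s)

  Reach⇒induced-walk : ∀ {P : Fin n → Set} {a b} → Reach a b → (∀ {x} → Reach a x → Reach x b → P x) →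
                       Star (InducedEdge G P) a b
  Reach⇒induced-walk ε       _       = ε
  Reach⇒induced-walk (a ◅ r) P-between =
    (P-between ε (a ◅ r) , P-between (a ◅ ε) r , arc⇒edge _ _ a) ◅
    Reach⇒induced-walk r (λ r₁ r₂ → P-between (a ◅ r₁) r₂)

  MinSourceReaches : Fin n → Fin n → Set
  MinSourceReaches v x = Reach (minSource x) v

  minSources-reaching-linked : ∀ {v w₁ w₂} → MinSourceReaches v w₁ → MinSourceReaches v w₂ →
                               Star (InducedEdge G (MinSourceReaches v)) w₁ w₂
  minSources-reaching-linked {v} r₁ r₂ =
    reverse flip (from-minSource r₁) ◅◅ toward-v r₁ ◅◅ reverse flip (toward-v r₂) ◅◅ from-minSource r₂
    where
    flip : ∀ {x y} → InducedEdge G (MinSourceReaches v) x y → InducedEdge G (MinSourceReaches v) y x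
    flip (Px , Py , e) = Py , Px , Graph.sym G _ _ e

    toward-v : ∀ {a} → Reach a v → Star (InducedEdge G (MinSourceReaches v)) a v
    toward-v r = Reach⇒induced-walk r λ {x} _ x→v → minSource-reaches x ◅◅ x→v

    from-minSource : ∀ {w} → MinSourceReaches v w → Star (InducedEdge G (MinSourceReaches v)) (minSource w) w
    from-minSource {w} r = Reach⇒induced-walk (minSource-reaches w)
      λ r₁ r₂ → subst (λ s → Reach s v) (sym (minSource-between r₁ r₂)) r

module _ {n} {H : Graph n} (O : AcyclicOrientation H) (D : TreeDecomposition H) where
  open AcyclicOrientation O
  open AcyclicOrientationProperties O
  open TreeDecomposition D

  minSourceBag : Node → Subset n
  minSourceBag l = image minSource (bag l)

  minSourceBag-coherent : ∀ {l i j} → OnPath l i j → ∀ v →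
                          InR (minSourceBag i) v → InR (minSourceBag j) v → InR (minSourceBag l) v
  minSourceBag-coherent {i = i} {j} l∈ij v (s₁ , s₁∈ , r₁) (s₂ , s₂∈ , r₂)
    with ∈-image⁻ minSource (bag i) s₁∈ | ∈-image⁻ minSource (bag j) s₂∈
  ... | w₁ , w₁∈ , refl | w₂ , w₂∈ , refl
    with induced-walk-meets-bag D (minSources-reaching-linked r₁ r₂) r₁ w₁∈ w₂∈ l∈ij
  ... | z , z-reaches , z∈ = minSource z , ∈-image⁺ minSource z∈ , z-reaches

  ∣minSourceBag∣≤∣bag∣ : ∀ l → ∣ minSourceBag l ∣ ≤ ∣ bag l ∣
  ∣minSourceBag∣≤∣bag∣ l = ∣image∣≤∣p∣ minSource (bag l)

  minSourceDecomposition : DAGTreeDecomposition O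
  minSourceDecomposition = record
    { tree     = tree
    ; bag      = minSourceBag
    ; sources  = λ l s s∈ → let (w , _ , w↦s) = ∈-image⁻ minSource (bag l) s∈
                           in subst IsSource w↦s (minSource-isSource w)
    ; scover   = λ s src → let (l , s∈) = vcover s
                           in l , subst (_∈ˢ minSourceBag l) (minSource-source src) (∈-image⁺ minSource s∈)
    ; coherent = minSourceBag-coherent
    }

mainTheorem18 : ∀ {n : ℕ} (H : Graph n) (O : AcyclicOrientation H) (m : ℕ)
                → TwPlusOneAtMost H m → DtwAtMost O m
mainTheorem18 H O m (D , bags≤m) =
  minSourceDecomposition O D , λ l → ≤-trans (∣minSourceBag∣≤∣bag∣ O D l) (bags≤m l)
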